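{- For every integer $n\ge 2$, ${\rm ndi}(K_n^*)=\Delta^*(K_n^*)+1=n$, where $K_n^*$ is the complete symmetric digraph of order $n$.
   Context: The complete symmetric digraph $K_n^*$ has $n$ vertices and, for every two distinct vertices $u,v$, both arcs $uv$ and $vu$. For a digraph $D$ (finite, no loops, no multiple arcs), $\Delta^*(D)$ is the maximum of the maximum outdegree and the maximum indegree. A (proper) $k$-arc-colouring of $D$ is a map $\gamma$ from $A(D)$ to a set of $k$ colours such that arcs with the same head get distinct colours and arcs with the same tail get distinct colours. $S_\gamma^+(u)$, $S_\gamma^-(u)$ are the sets of colours on arcs with tail $u$, resp. head $u$. $\gamma$ is neighbour-distinguishing if for every arc $uv$, $(S_\gamma^+(u),S_\gamma^-(u))\neq(S_\gamma^+(v),S_\gamma^-(v))$ as ordered pairs. ${\rm ndi}(D)$ is the minimum number of colours of a neighbour-distinguishing arc-colouring of $D$. -}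

module Defs where

open import Data.Nat using (ℕ; _≤_; _⊔_)
open import Data.Bool using (Bool; true; false; T; not)
open import Data.Fin using (Fin; _≟_)
open import Data.Fin.Base using ()
open import Data.List using (List; length; filter; map; foldr)
open import Data.List.Base using ()
open import Data.Fin.Base using ()
open import Data.Product using (Σ; ∃; _×_)
open import Relation.Binary.PropositionalEquality using (_≡_; _≢_)
open import Relation.Nullary using (¬_; does)
open import Relation.Nullary.Decidable using (⌊_⌋)
open import Function.Bundles using (_⇔_)
import Data.List as L

allVertices : (n : ℕ) → List (Fin n)
allVertices n = L.allFin n

record Digraph : Set where
  field
    order : ℕ
    arc   : Fin order → Fin order → Bool
    loopless : ∀ u → arc u u ≡ false
open Digraph public

K* : ℕ → Digraph
K* n = record { order = n ; arc = λ u v → not ⌊ u ≟ v ⌋ ; loopless = lemma }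
  where
  open import Relation.Nullary using (yes; no)
  open import Relation.Binary.PropositionalEquality using (refl)
  lemma : ∀ u → not ⌊ u ≟ u ⌋ ≡ false
  lemma u with u ≟ u
  ... | yes _ = refl
  ... | no ¬p = ⊥-elim (¬p refl)
    where open import Data.Empty using (⊥-elim)

outdeg : (D : Digraph) → Fin (order D) → ℕ
outdeg D u = length (L.filter (λ v → T? (arc D u v)) (allVertices (order D)))
  where open import Data.Bool.Properties using (T?)

indeg : (D : Digraph) → Fin (order D) → ℕ
indeg D u = length (L.filter (λ v → T? (arc D v u)) (allVertices (order D)))
  where open import Data.Bool.Properties using (T?)

-- Δ*(D) = max of maximum outdegree and maximum indegree
Δ* : Digraph → ℕ
Δ* D = foldr _⊔_ 0 (map (λ u → outdeg D u ⊔ indeg D u) (allVertices (order D)))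

ArcColouring : Digraph → ℕ → Set
ArcColouring D k = (u v : Fin (order D)) → T (arc D u v) → Fin k

Proper : (D : Digraph) {k : ℕ} → ArcColouring D k → Set
Proper D γ =
  (∀ u v w (p : T (arc D u v)) (q : T (arc D u w)) → v ≢ w → γ u v p ≢ γ u w q) ×
  (∀ u v w (p : T (arc D v u)) (q : T (arc D w u)) → v ≢ w → γ v u p ≢ γ w u q)

InS⁺ : (D : Digraph) {k : ℕ} → ArcColouring D k → Fin (order D) → Fin k → Set
InS⁺ D γ u c = ∃ λ v → Σ (T (arc D u v)) λ p → γ u v p ≡ c

InS⁻ : (D : Digraph) {k : ℕ} → ArcColouring D k → Fin (order D) → Fin k → Set
InS⁻ D γ u c = ∃ λ v → Σ (T (arc D v u)) λ p → γ v u p ≡ c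

SamePair : (D : Digraph) {k : ℕ} → ArcColouring D k → Fin (order D) → Fin (order D) → Set
SamePair D γ u v = ∀ c → (InS⁺ D γ u c ⇔ InS⁺ D γ v c) × (InS⁻ D γ u c ⇔ InS⁻ D γ v c)

NeighbourDistinguishing : (D : Digraph) {k : ℕ} → ArcColouring D k → Set
NeighbourDistinguishing D γ = ∀ u v → T (arc D u v) → ¬ SamePair D γ u v

HasNDColouring : Digraph → ℕ → Set
HasNDColouring D k = Σ (ArcColouring D k) λ γ → Proper D γ × NeighbourDistinguishing D γ

NdiIs : Digraph → ℕ → Set
NdiIs D k = HasNDColouring D k × (∀ m → HasNDColouring D m → k ≤ m)

module Submission where

-- Every vertex of K*ₙ has in- and outdegree n - 1, so Δ*(K*ₙ) = n - 1.
-- In a proper colouring the colours on the arcs out of (into) a vertex form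
-- an injective image of its n - 1 neighbours.  Counting facts about
-- injections between finite sets then give both bounds:
-- * lower bound: with at most n - 1 colours these injections are onto, so all
--   vertices see every colour in both directions and no two are distinguished;
-- * upper bound: colour uv with v - u - 1 if u < v and with n + v - u if v < u.
--   Tail and colour determine the head, head and colour determine the tail,
--   and no arc into v has colour v; so the arcs into u carry exactly the
--   colours other than u, and S⁻(u) ∋ v ∉ S⁻(v) for every arc uv.

open import Defs
open import Data.Nat using (ℕ; _≤_; _+_)
open import Data.Product using (_×_)
open import Relation.Binary.PropositionalEquality using (_≡_)

open import Data.Nat using (zero; suc; s≤s; pred; _<_; _∸_; _⊔_; _<?_)
open import Data.Nat.Properties
  using ( <-cmp; ≤-refl; ≤-trans; <⇒≢; >⇒≢; ≤⇒≯; ≮⇒≥; ≤-pred; +-comm; +-suc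
        ; +-monoʳ-<; +-monoˡ-<; +-cancelˡ-<; m≤m+n; m≤n+m; m∸n≤m; <⇒≤
        ; m+n∸n≡m; m+n∸m≡n; m+[n∸m]≡n; ≤-<-trans; ⊔-idem; ⊔-identityʳ
        ; module ≤-Reasoning)
open import Data.Fin as Fin using (Fin; toℕ; fromℕ<; punchIn; punchOut; _≟_)
open import Data.Fin.Properties
  using ( toℕ<n; toℕ-fromℕ<; toℕ-injective; 0≢1+n; suc-injective; any?; pigeonhole
        ; punchIn-injective; punchInᵢ≢i; punchOut-injective)
open import Data.Bool using (T)
open import Data.Bool.Properties using (T?)
open import Data.List using ([]; _∷_; length; filter; map; foldr; tabulate; allFin)
open import Data.List.Properties using (filter-≐; filter-accept; filter-reject; filter-all; length-tabulate)
open import Data.List.Relation.Unary.All.Properties using (tabulate⁺)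
open import Data.Product using (∃; _,_; proj₂)
open import Function using (id; _∘_)
open import Function.Bundles using (mk⇔; Equivalence)
open import Function.Definitions using (Injective)
open import Relation.Unary using (Decidable)
open import Relation.Nullary using (yes; no; ¬?; contradiction)
open import Relation.Nullary.Decidable using (toWitnessFalse; fromWitnessFalse)
open import Relation.Binary.Definitions using (tri<; tri≈; tri>)
open import Relation.Binary.PropositionalEquality
  using (_≢_; refl; sym; trans; cong; cong₂; subst; ≢-sym; module ≡-Reasoning)

arc⇒≢ : ∀ {n} {u v : Fin n} → T (arc (K* n) u v) → u ≢ v
arc⇒≢ = toWitnessFalse

≢⇒arc : ∀ {n} {u v : Fin n} → u ≢ v → T (arc (K* n) u v)
≢⇒arc = fromWitnessFalse

differsFrom? : ∀ {n} (u : Fin n) → Decidable (u ≢_)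
differsFrom? u x = ¬? (u ≟ x)

count-others : ∀ {k n} (f : Fin k → Fin n) → Injective _≡_ _≡_ f → (i : Fin k) →
               length (filter (differsFrom? (f i)) (tabulate f)) ≡ pred k
count-others {suc k} f inj Fin.zero = begin
  length (filter P? (f Fin.zero ∷ tabulate (f ∘ Fin.suc)))
    ≡⟨ cong length (filter-reject P? (λ f0≢f0 → f0≢f0 refl)) ⟩
  length (filter P? (tabulate (f ∘ Fin.suc)))
    ≡⟨ cong length (filter-all P? (tabulate⁺ (λ j → 0≢1+n {i = j} ∘ inj))) ⟩
  length (tabulate (f ∘ Fin.suc))
    ≡⟨ length-tabulate (f ∘ Fin.suc) ⟩
  k ∎
  where
  open ≡-Reasoning
  P? = differsFrom? (f Fin.zero)
count-others {suc (suc k)} f inj (Fin.suc i) = begin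
  length (filter P? (f Fin.zero ∷ tabulate (f ∘ Fin.suc)))
    ≡⟨ cong length (filter-accept P? (0≢1+n ∘ sym ∘ inj)) ⟩
  suc (length (filter P? (tabulate (f ∘ Fin.suc))))
    ≡⟨ cong suc (count-others (f ∘ Fin.suc) (suc-injective ∘ inj) i) ⟩
  suc k ∎
  where
  open ≡-Reasoning
  P? = differsFrom? (f (Fin.suc i))

outdeg-K* : ∀ {n} (u : Fin n) → outdeg (K* n) u ≡ pred n
outdeg-K* {n} u = trans
  (cong length (filter-≐ (λ v → T? (arc (K* n) u v)) (differsFrom? u)
                         (arc⇒≢ , ≢⇒arc) (allFin n)))
  (count-others id id u)

indeg-K* : ∀ {n} (u : Fin n) → indeg (K* n) u ≡ pred n
indeg-K* {n} u = trans
  (cong length (filter-≐ (λ v → T? (arc (K* n) v u)) (differsFrom? u)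
                         (≢-sym ∘ arc⇒≢ , ≢⇒arc ∘ ≢-sym) (allFin n)))
  (count-others id id u)

max-of-constant : ∀ {A : Set} (g : A → ℕ) {c : ℕ} → (∀ a → g a ≡ c) →
                  ∀ x xs → foldr _⊔_ 0 (map g (x ∷ xs)) ≡ c
max-of-constant g g≡c x [] = trans (⊔-identityʳ (g x)) (g≡c x)
max-of-constant g g≡c x (y ∷ ys) =
  trans (cong₂ _⊔_ (g≡c x) (max-of-constant g g≡c y ys)) (⊔-idem _)

Δ*-K* : ∀ k → Δ* (K* (suc k)) ≡ k
Δ*-K* k = max-of-constant degree degree≡k Fin.zero (tabulate Fin.suc)
  where
  degree : Fin (suc k) → ℕ
  degree u = outdeg (K* (suc k)) u ⊔ indeg (K* (suc k)) u
  degree≡k : ∀ u → degree u ≡ k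
  degree≡k u = trans (cong₂ _⊔_ (outdeg-K* u) (indeg-K* u)) (⊔-idem k)

-- An injection Fin k → Fin m with m ≤ k is onto (a missed value would let the
-- injection factor through Fin (m - 1), contradicting the pigeonhole principle).
injection-onto : ∀ {k m} (f : Fin k → Fin m) → Injective _≡_ _≡_ f → m ≤ k →
                 ∀ d → ∃ λ i → f i ≡ d
injection-onto {m = suc m} f inj m≤k d with any? (λ i → f i ≟ d)
... | yes hit = hit
... | no miss =
  let avoids : ∀ i → d ≢ f i
      avoids i d≡fi = miss (i , sym d≡fi)
      (i , j , i<j , same) = pigeonhole m≤k (λ i → punchOut (avoids i))
  in contradiction (cong toℕ (inj (punchOut-injective (avoids i) (avoids j) same))) (<⇒≢ i<j)

injection-onto-except : ∀ {k} (f : Fin k → Fin (suc k)) → Injective _≡_ _≡_ f →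
                        ∀ {c} → (∀ i → f i ≢ c) → ∀ d → d ≢ c → ∃ λ i → f i ≡ d
injection-onto-except f inj {c} miss d d≢c
  with i , same ← injection-onto (λ i → punchOut (≢-sym (miss i)))
                    (λ {i} {j} same → inj (punchOut-injective (≢-sym (miss i)) (≢-sym (miss j)) same))
                    ≤-refl (punchOut (≢-sym d≢c))
  = i , punchOut-injective (≢-sym (miss i)) (≢-sym d≢c) same

-- For u : Fin (k + 1), the other vertices of K*ₖ₊₁ are punchIn u j, j : Fin k;
-- these maps list the colours of the arcs into u and out of u.
module _ {k m : ℕ} (δ : ArcColouring (K* (suc k)) m) where

  inColour : Fin (suc k) → Fin k → Fin m
  inColour u j = δ (punchIn u j) u (≢⇒arc (punchInᵢ≢i u j))

  outColour : Fin (suc k) → Fin k → Fin m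
  outColour u j = δ u (punchIn u j) (≢⇒arc (≢-sym (punchInᵢ≢i u j)))

  inColour-injective : Proper (K* (suc k)) δ → ∀ u → Injective _≡_ _≡_ (inColour u)
  inColour-injective (_ , proper⁻) u {i} {j} same with i ≟ j
  ... | yes i≡j = i≡j
  ... | no i≢j = contradiction same (proper⁻ u _ _ _ _ (i≢j ∘ punchIn-injective u i j))

  outColour-injective : Proper (K* (suc k)) δ → ∀ u → Injective _≡_ _≡_ (outColour u)
  outColour-injective (proper⁺ , _) u {i} {j} same with i ≟ j
  ... | yes i≡j = i≡j
  ... | no i≢j = contradiction same (proper⁺ u _ _ _ _ (i≢j ∘ punchIn-injective u i j))

  inColour-seen : ∀ u j → InS⁻ (K* (suc k)) δ u (inColour u j)
  inColour-seen u j = punchIn u j , _ , refl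

  outColour-seen : ∀ u j → InS⁺ (K* (suc k)) δ u (outColour u j)
  outColour-seen u j = punchIn u j , _ , refl

-- With at most k colours on K*ₖ₊₁, properness forces every vertex to see
-- every colour in both directions, so all vertices carry the same pair.
few-colours-same-pair : ∀ {k m} (δ : ArcColouring (K* (suc k)) m) → m ≤ k →
                        Proper (K* (suc k)) δ → ∀ u v → SamePair (K* (suc k)) δ u v
few-colours-same-pair {k} δ m≤k proper u v c =
  mk⇔ (λ _ → all⁺ v) (λ _ → all⁺ u) , mk⇔ (λ _ → all⁻ v) (λ _ → all⁻ u)
  where
  all⁺ : ∀ w → InS⁺ (K* (suc k)) δ w c
  all⁺ w with j , refl ← injection-onto (outColour δ w) (outColour-injective δ proper w) m≤k c
    = outColour-seen δ w j
  all⁻ : ∀ w → InS⁻ (K* (suc k)) δ w c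
  all⁻ w with j , refl ← injection-onto (inColour δ w) (inColour-injective δ proper w) m≤k c
    = inColour-seen δ w j

-- Fewer than n colours never suffice on K*ₙ for n ≥ 2: vertices 0 and 1 are
-- adjacent but carry the same pair of colour sets.
lower-bound : ∀ k m → HasNDColouring (K* (suc (suc k))) m → suc (suc k) ≤ m
lower-bound k m (δ , proper , distinguishing) = ≮⇒≥ λ m<n →
  distinguishing Fin.zero (Fin.suc Fin.zero) _
    (few-colours-same-pair δ (≤-pred m<n) proper Fin.zero (Fin.suc Fin.zero))

arcColourℕ : ℕ → ℕ → ℕ → ℕ
arcColourℕ n u v with v <? u
... | yes _ = n + v ∸ u
... | no  _ = v ∸ suc u

module _ {n u v : ℕ} where

  forward-colour : u < v → u + suc (arcColourℕ n u v) ≡ v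
  forward-colour u<v with v <? u
  ... | yes v<u = contradiction v<u (≤⇒≯ (<⇒≤ u<v))
  ... | no  _   = trans (+-suc u (v ∸ suc u)) (m+[n∸m]≡n u<v)

  backward-colour : v < u → u ≤ n → u + arcColourℕ n u v ≡ n + v
  backward-colour v<u u≤n with v <? u
  ... | yes _   = m+[n∸m]≡n (≤-trans u≤n (m≤m+n n v))
  ... | no  v≮u = contradiction v<u v≮u

  arcColour<n : u < n → v < n → arcColourℕ n u v < n
  arcColour<n u<n v<n with v <? u
  ... | yes v<u = +-cancelˡ-< u _ n (begin-strict
    u + (n + v ∸ u) ≡⟨ m+[n∸m]≡n (≤-trans (<⇒≤ u<n) (m≤m+n n v)) ⟩
    n + v           <⟨ +-monoʳ-< n v<u ⟩
    n + u           ≡⟨ +-comm n u ⟩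
    u + n           ∎)
    where open ≤-Reasoning
  ... | no  _ = ≤-<-trans (m∸n≤m v (suc u)) v<n

  forward-below : u < v → arcColourℕ n u v < v
  forward-below u<v = subst (suc (arcColourℕ n u v) ≤_) (forward-colour u<v)
                            (m≤n+m (suc (arcColourℕ n u v)) u)

  backward-above : v < u → u < n → v < arcColourℕ n u v
  backward-above v<u u<n = +-cancelˡ-< n v _ (begin-strict
    n + v                 ≡⟨ sym (backward-colour v<u (<⇒≤ u<n)) ⟩
    u + arcColourℕ n u v  <⟨ +-monoˡ-< (arcColourℕ n u v) u<n ⟩
    n + arcColourℕ n u v  ∎)
    where open ≤-Reasoning

headOf : ℕ → ℕ → ℕ → ℕ
headOf n u c with u + c <? n
... | yes _ = u + suc c
... | no  _ = u + c ∸ n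

tailOf : ℕ → ℕ → ℕ → ℕ
tailOf n v c with c <? v
... | yes _ = v ∸ suc c
... | no  _ = n + v ∸ c

module _ {n u v : ℕ} (u≢v : u ≢ v) (u<n : u < n) (v<n : v < n) where

  private
    c = arcColourℕ n u v

  -- Tail and colour determine the head: forward arcs have u + c < n,
  -- backward arcs u + c = n + v ≥ n.
  headOf-colour : headOf n u c ≡ v
  headOf-colour with <-cmp u v | u + c <? n
  ... | tri≈ _ u≡v _ | _ = contradiction u≡v u≢v
  ... | tri< u<v _ _ | yes _ = forward-colour u<v
  ... | tri< u<v _ _ | no u+c≮n = contradiction (subst (_≤ n) (sym u+c+1≡v) (<⇒≤ v<n)) u+c≮n
    where
    u+c+1≡v : suc (u + c) ≡ v
    u+c+1≡v = trans (sym (+-suc u c)) (forward-colour u<v)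
  ... | tri> _ _ v<u | yes u+c<n =
    contradiction u+c<n (≤⇒≯ (subst (n ≤_) (sym (backward-colour v<u (<⇒≤ u<n))) (m≤m+n n v)))
  ... | tri> _ _ v<u | no _ = trans (cong (_∸ n) (backward-colour v<u (<⇒≤ u<n))) (m+n∸m≡n n v)

  -- Head and colour determine the tail: forward arcs have c < v,
  -- backward arcs c > v.
  tailOf-colour : tailOf n v c ≡ u
  tailOf-colour with <-cmp u v | c <? v
  ... | tri≈ _ u≡v _ | _ = contradiction u≡v u≢v
  ... | tri< u<v _ _ | yes _ =
    trans (cong (_∸ suc c) (sym (forward-colour u<v))) (m+n∸n≡m u (suc c))
  ... | tri< u<v _ _ | no c≮v = contradiction (forward-below u<v) c≮v
  ... | tri> _ _ v<u | yes c<v = contradiction c<v (≤⇒≯ (<⇒≤ (backward-above v<u u<n)))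
  ... | tri> _ _ v<u | no _ =
    trans (cong (_∸ c) (sym (backward-colour v<u (<⇒≤ u<n)))) (m+n∸n≡m u c)

  colour≢head : c ≢ v
  colour≢head with <-cmp u v
  ... | tri< u<v _ _ = <⇒≢ (forward-below u<v)
  ... | tri≈ _ u≡v _ = contradiction u≡v u≢v
  ... | tri> _ _ v<u = >⇒≢ (backward-above v<u u<n)

arcColour : ∀ {n} → Fin n → Fin n → Fin n
arcColour u v = fromℕ< (arcColour<n (toℕ<n u) (toℕ<n v))

toℕ-arcColour : ∀ {n} (u v : Fin n) → toℕ (arcColour u v) ≡ arcColourℕ n (toℕ u) (toℕ v)
toℕ-arcColour u v = toℕ-fromℕ< (arcColour<n (toℕ<n u) (toℕ<n v))

toℕ-≢ : ∀ {n} {x y : Fin n} → x ≢ y → toℕ x ≢ toℕ y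
toℕ-≢ x≢y = x≢y ∘ toℕ-injective

module _ {n : ℕ} {u v : Fin n} (u≢v : u ≢ v) where

  arcColour-headInjective : ∀ {w} → u ≢ w → arcColour u v ≡ arcColour u w → v ≡ w
  arcColour-headInjective {w} u≢w same = toℕ-injective (begin
    toℕ v
      ≡⟨ sym (headOf-colour (toℕ-≢ u≢v) (toℕ<n u) (toℕ<n v)) ⟩
    headOf n (toℕ u) (arcColourℕ n (toℕ u) (toℕ v))
      ≡⟨ cong (headOf n (toℕ u)) colours ⟩
    headOf n (toℕ u) (arcColourℕ n (toℕ u) (toℕ w))
      ≡⟨ headOf-colour (toℕ-≢ u≢w) (toℕ<n u) (toℕ<n w) ⟩
    toℕ w ∎)
    where
    open ≡-Reasoning
    colours : arcColourℕ n (toℕ u) (toℕ v) ≡ arcColourℕ n (toℕ u) (toℕ w)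
    colours = trans (sym (toℕ-arcColour u v)) (trans (cong toℕ same) (toℕ-arcColour u w))

  arcColour-tailInjective : ∀ {w} → w ≢ v → arcColour u v ≡ arcColour w v → u ≡ w
  arcColour-tailInjective {w} w≢v same = toℕ-injective (begin
    toℕ u
      ≡⟨ sym (tailOf-colour (toℕ-≢ u≢v) (toℕ<n u) (toℕ<n v)) ⟩
    tailOf n (toℕ v) (arcColourℕ n (toℕ u) (toℕ v))
      ≡⟨ cong (tailOf n (toℕ v)) colours ⟩
    tailOf n (toℕ v) (arcColourℕ n (toℕ w) (toℕ v))
      ≡⟨ tailOf-colour (toℕ-≢ w≢v) (toℕ<n w) (toℕ<n v) ⟩
    toℕ w ∎)
    where
    open ≡-Reasoning
    colours : arcColourℕ n (toℕ u) (toℕ v) ≡ arcColourℕ n (toℕ w) (toℕ v)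
    colours = trans (sym (toℕ-arcColour u v)) (trans (cong toℕ same) (toℕ-arcColour w v))

  arcColour≢head : arcColour u v ≢ v
  arcColour≢head same = colour≢head (toℕ-≢ u≢v) (toℕ<n u) (toℕ<n v)
                                    (trans (sym (toℕ-arcColour u v)) (cong toℕ same))

shiftColouring : ∀ n → ArcColouring (K* n) n
shiftColouring n u v _ = arcColour u v

shiftColouring-proper : ∀ n → Proper (K* n) (shiftColouring n)
shiftColouring-proper n =
  (λ u v w uv uw v≢w → v≢w ∘ arcColour-headInjective (arc⇒≢ uv) (arc⇒≢ uw)) ,
  (λ u v w vu wu v≢w → v≢w ∘ arcColour-tailInjective (arc⇒≢ vu) (arc⇒≢ wu))

colour-into : ∀ k (u v : Fin (suc k)) → u ≢ v → InS⁻ (K* (suc k)) (shiftColouring (suc k)) u v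
colour-into k u v u≢v
  with j , refl ← injection-onto-except (inColour (shiftColouring (suc k)) u)
                    (inColour-injective (shiftColouring (suc k)) (shiftColouring-proper (suc k)) u)
                    (λ j → arcColour≢head (punchInᵢ≢i u j)) v (≢-sym u≢v)
  = inColour-seen (shiftColouring (suc k)) u j

-- For an arc uv, colour v lies in S⁻(u) but not in S⁻(v).
shiftColouring-distinguishing : ∀ k → NeighbourDistinguishing (K* (suc k)) (shiftColouring (suc k))
shiftColouring-distinguishing k u v uv same
  with w , wv , colour≡v ← Equivalence.to (proj₂ (same v)) (colour-into k u v (arc⇒≢ uv))
  = arcColour≢head (arc⇒≢ wv) colour≡v

upper-bound : ∀ k → HasNDColouring (K* (suc k)) (suc k)
upper-bound k = shiftColouring (suc k) , shiftColouring-proper (suc k) , shiftColouring-distinguishing k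

theorem7 : (n : ℕ) → 2 ≤ n → NdiIs (K* n) (Δ* (K* n) + 1) × Δ* (K* n) + 1 ≡ n
theorem7 (suc zero) (s≤s ())
theorem7 (suc (suc k)) _ =
  subst (NdiIs (K* n)) (sym Δ*+1≡n) (upper-bound (suc k) , lower-bound k) , Δ*+1≡n
  where
  n = suc (suc k)
  Δ*+1≡n : Δ* (K* n) + 1 ≡ n
  Δ*+1≡n = trans (cong (_+ 1) (Δ*-K* (suc k))) (+-comm (suc k) 1)
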